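{- Let $G$ be a cactus graph with cycles $C_1,\ldots,C_c$ and let $S$ be a biactive branch-resolving set in $G$. If $S$ is a vertex (resp. an edge) metric generator in $G$, then no pair of cycles of $G$ is vertex-critically (resp. edge-critically) incident with respect to $S$.
   Context: All graphs are finite, simple and connected; for a vertex $u$ and edge $vw$, $d(u,vw)=\min\{d(u,v),d(u,w)\}$. A vertex $s$ distinguishes vertices (resp. edges) $x,x'$ if $d(s,x)\ne d(s,x')$; $S\subseteq V(G)$ is a vertex (resp. edge) metric generator if every pair of distinct vertices (resp. edges) is distinguished by some vertex of $S$. A cactus graph is a connected graph whose cycles are pairwise edge-disjoint; $g_i$ is the length of $C_i$. A thread hanging at a vertex $v$ of degree $\ge3$ is a path $u_1\cdots u_k$ ($k\ge1$) with $u_1$ a leaf, $u_2,\dots,u_k$ of degree 2 and $u_k$ adjacent to $v$; it is $S$-free if it contains no vertex of $S$. $S$ is branch-resolving if at every vertex of degree $\ge3$ at most one $S$-free thread hangs. For $v\in V(C_i)$, $T_v(C_i)$ is the component of $G-E(C_i)$ containing $v$; $v$ is $S$-active on $C_i$ if $T_v(C_i)$ contains a vertex of $S$. $S$ is biactive if every cycle has at least two $S$-active vertices. An $S$-path $P_i$ of $C_i$ is a subpath of $C_i$ of minimum possible length containing all $S$-active vertices of $C_i$; $|P_i|$ denotes its length (number of edges). A vertex $v\in V(C_i)$ is vertex-critical (resp. edge-critical) on $C_i$ with respect to $S$ if $v$ is an end-vertex of an $S$-path $P_i$ and $|P_i|\le\lfloor g_i/2\rfloor-1$ (resp. $|P_i|\le\lceil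 g_i/2\rceil-1$). Two distinct cycles $C_i,C_j$ are vertex-critically (resp. edge-critically) incident with respect to $S$ if they share a vertex which is vertex-critical (resp. edge-critical) with respect to $S$ on both $C_i$ and $C_j$. -}

module Defs where

open import Data.Nat using (ℕ; zero; suc; _+_; _∸_; _≤_; _<_; _⊓_; ⌊_/2⌋; ⌈_/2⌉)
open import Data.Nat.DivMod using (_mod_)
open import Data.Fin using (Fin; toℕ)
open import Data.Fin.Subset using (Subset; _∈_)
open import Data.List using (List; []; _∷_; length; filter; allFin; last)
open import Data.List.Relation.Unary.Unique.Propositional using (Unique)
open import Data.Maybe using (just)
open import Data.Unit using (⊤)
open import Data.Empty using (⊥)
open import Data.List.Membership.Propositional using () renaming (_∈_ to _∈ₗ_)
open import Data.Product using (Σ; ∃; ∃-syntax; _×_; _,_)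
open import Data.Sum using (_⊎_)
open import Function.Definitions using (Injective)
open import Relation.Nullary using (¬_)
open import Relation.Binary using (Decidable)
open import Relation.Binary.PropositionalEquality using (_≡_; _≢_)

record Graph : Set₁ where
  field
    n     : ℕ
    Adj   : Fin n → Fin n → Set
    adj?  : Decidable Adj
    sym   : ∀ {u v} → Adj u v → Adj v u
    irrefl : ∀ {u} → ¬ Adj u u

module _ (G : Graph) where
  open Graph G

  V : Set
  V = Fin n

  deg : V → ℕ
  deg u = length (filter (adj? u) (allFin n))

data Walk {A : Set} (R : A → A → Set) : A → A → ℕ → Set where
  nil  : ∀ {u} → Walk R u u zero
  cons : ∀ {u w v k} → R u w → Walk R w v k → Walk R u v (suc k)

module _ (G : Graph) where
  open Graph G

  Connected : Set
  Connected = ∀ (u v : V G) → ∃[ k ] Walk Adj u v k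

  Dist : V G → V G → ℕ → Set
  Dist u v k = Walk Adj u v k × (∀ m → Walk Adj u v m → k ≤ m)

  EdgeDist : V G → V G → V G → ℕ → Set
  EdgeDist u v w k = ∃[ a ] ∃[ b ] (Dist u v a × Dist u w b × k ≡ a ⊓ b)

  DistinguishesV : V G → V G → V G → Set
  DistinguishesV s x x' = ∀ a b → Dist s x a → Dist s x' b → a ≢ b

  VertexMetricGenerator : Subset n → Set
  VertexMetricGenerator S =
    ∀ (x x' : V G) → x ≢ x' → ∃[ s ] (s ∈ S × DistinguishesV s x x')

  -- edges are pairs (v , w) with Adj v w; edges vw and v'w' coincide iff
  -- {v,w} = {v',w'}
  SameEdge : V G → V G → V G → V G → Set
  SameEdge v w v' w' = (v ≡ v' × w ≡ w') ⊎ (v ≡ w' × w ≡ v')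

  DistinguishesE : V G → V G → V G → V G → V G → Set
  DistinguishesE s v w v' w' =
    ∀ a b → EdgeDist s v w a → EdgeDist s v' w' b → a ≢ b

  EdgeMetricGenerator : Subset n → Set
  EdgeMetricGenerator S =
    ∀ (v w v' w' : V G) → Adj v w → Adj v' w' → ¬ SameEdge v w v' w' →
    ∃[ s ] (s ∈ S × DistinguishesE s v w v' w')

  -- cycles: a cyclic sequence of g = 3 + m distinct vertices,
  -- consecutive ones (cyclically) adjacent

  record Cycle : Set where
    field
      m        : ℕ
      vtx      : Fin (3 + m) → V G
      vtx-inj  : Injective _≡_ _≡_ vtx
      vtx-adj  : ∀ (j : ℕ) → Adj (vtx (j mod (3 + m))) (vtx (suc j mod (3 + m)))

    g : ℕ
    g = 3 + m

    at : ℕ → V G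
    at j = vtx (j mod g)

    OnCycle : V G → Set
    OnCycle v = ∃[ i ] v ≡ vtx i

    CycEdge : V G → V G → Set
    CycEdge u w = ∃[ j ] ((u ≡ at j × w ≡ at (suc j)) ⊎ (w ≡ at j × u ≡ at (suc j)))

  open Cycle public

  -- two cycles are the same (sub)graph iff they have the same edge set
  SameCycle : Cycle → Cycle → Set
  SameCycle C D = ∀ u w → (CycEdge C u w → CycEdge D u w) × (CycEdge D u w → CycEdge C u w)

  Cactus : Set
  Cactus = Connected ×
    (∀ (C D : Cycle) → ¬ SameCycle C D → ∀ u w → CycEdge C u w → ¬ CycEdge D u w)

  IsPathList : List (V G) → Set
  IsPathList [] = ⊤
  IsPathList (u ∷ []) = ⊤
  IsPathList (u ∷ w ∷ us) = Adj u w × IsPathList (w ∷ us)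

  AllDeg2 : List (V G) → Set
  AllDeg2 [] = ⊤
  AllDeg2 (u ∷ us) = deg G u ≡ 2 × AllDeg2 us

  Thread : V G → List (V G) → Set
  Thread v [] = ⊥
  Thread v (u₁ ∷ us) =
    3 ≤ deg G v × IsPathList (u₁ ∷ us) × Unique (u₁ ∷ us) ×
    deg G u₁ ≡ 1 × AllDeg2 us × ∃[ uk ] (last (u₁ ∷ us) ≡ just uk × Adj uk v)

  SFree : Subset n → List (V G) → Set
  SFree S us = ∀ u → u ∈ₗ us → ¬ (u ∈ S)

  BranchResolving : Subset n → Set
  BranchResolving S = ∀ (v : V G) → 3 ≤ deg G v →
    ∀ t t' → Thread v t → Thread v t' → SFree S t → SFree S t' → t ≡ t'

  AdjOff : Cycle → V G → V G → Set
  AdjOff C u w = Adj u w × ¬ CycEdge C u w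

  InT : Cycle → V G → V G → Set
  InT C v x = ∃[ k ] Walk (AdjOff C) v x k

  Active : Subset n → Cycle → V G → Set
  Active S C v = OnCycle C v × ∃[ s ] (s ∈ S × InT C v s)

  Biactive : Subset n → Set
  Biactive S = ∀ (C : Cycle) → ∃[ i ] ∃[ j ]
    (i ≢ j × Active S C (vtx C i) × Active S C (vtx C j))

  Covers : Subset n → (C : Cycle) → Fin (g C) → ℕ → Set
  Covers S C i ℓ = ℓ < g C ×
    (∀ (j : Fin (g C)) → Active S C (vtx C j) →
       ∃[ t ] (t ≤ ℓ × vtx C j ≡ at C (toℕ i + t)))

  IsSPath : Subset n → (C : Cycle) → Fin (g C) → ℕ → Set
  IsSPath S C i ℓ = Covers S C i ℓ × (∀ i' ℓ' → Covers S C i' ℓ' → ℓ ≤ ℓ')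

  EndOfSPathWithin : Subset n → Cycle → ℕ → V G → Set
  EndOfSPathWithin S C bound v = ∃[ i ] ∃[ ℓ ]
    (IsSPath S C i ℓ × (v ≡ at C (toℕ i) ⊎ v ≡ at C (toℕ i + ℓ)) × ℓ ≤ bound)

  VertexCritical : Subset n → Cycle → V G → Set
  VertexCritical S C v = EndOfSPathWithin S C (⌊ g C /2⌋ ∸ 1) v

  EdgeCritical : Subset n → Cycle → V G → Set
  EdgeCritical S C v = EndOfSPathWithin S C (⌈ g C /2⌉ ∸ 1) v

  VertexCriticallyIncident : Subset n → Cycle → Cycle → Set
  VertexCriticallyIncident S C D = ¬ SameCycle C D ×
    ∃[ v ] (VertexCritical S C v × VertexCritical S D v)

  EdgeCriticallyIncident : Subset n → Cycle → Cycle → Set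
  EdgeCriticallyIncident S C D = ¬ SameCycle C D ×
    ∃[ v ] (EdgeCritical S C v × EdgeCritical S D v)

{-# OPTIONS --safe #-}
-- Let v be an end of a short S-path of C and let x be the next vertex of C beyond it. Every vertex s
-- hangs off C at a unique vertex c (two distinct vertices of C joined in G − E(C) would close up a
-- second cycle sharing an edge with C), so every s–x walk passes through c; for s ∈ S this c is
-- S-active, hence on the S-path, and since the S-path is short, going round C from c reaches v at
-- least δ steps before x, with δ = 1 under the vertex bound ⌊g/2⌋ − 1 and δ = 0 under the edge bound
-- ⌈g/2⌉ − 1. So d(s,x) = d(s,v) + 1, resp. d(s,vx) = d(s,v), for every s ∈ S. A vertex critical on
-- both C and D thus gets such neighbours x on C and y on D, distinct because the cycles of a cactus
-- are edge-disjoint, and no vertex of S distinguishes x from y, resp. vx from vy.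

module Submission where

open import Data.Empty using (⊥; ⊥-elim)
open import Data.Fin using (Fin; toℕ)
open import Data.Fin.Properties using (any?; toℕ<n; toℕ-fromℕ<; toℕ-injective)
  renaming (_≟_ to _≟ᶠ_)
open import Data.Fin.Subset using (Subset; _∈_)
open import Data.Nat
  using (ℕ; zero; suc; pred; _+_; _∸_; _≤_; _<_; z≤n; s≤s; _⊓_; NonZero; _<?_; _≤?_; ⌊_/2⌋; ⌈_/2⌉)
open import Data.Nat.DivMod
  using (_%_; _mod_; %-distribˡ-+; m%n%n≡m%n; m<n⇒m%n≡m; [m+n]%n≡m%n; m%n<n; n%n≡0)
open import Data.Nat.Induction using (<-rec)
open import Data.Nat.Properties
open import Data.Nat.Tactic.RingSolver using (solve-∀)
open import Data.Product using (∃; ∃-syntax; _×_; _,_; proj₁; proj₂)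
open import Data.Sum using (_⊎_; inj₁; inj₂)
open import Relation.Binary using (tri<; tri≈; tri>)
open import Relation.Binary.PropositionalEquality
open import Relation.Nullary using (¬_; Dec; yes; no)
open import Relation.Nullary.Decidable using (_×-dec_; _⊎-dec_; map′)

open import Defs

module _ {A : Set} {R : A → A → Set} where

  infixr 5 _++ʷ_

  _++ʷ_ : ∀ {u v w k l} → Walk R u v k → Walk R v w l → Walk R u w (k + l)
  nil      ++ʷ W′ = W′
  cons e W ++ʷ W′ = cons e (W ++ʷ W′)

  snocʷ : ∀ {u v w k} → Walk R u v k → R v w → Walk R u w (suc k)
  snocʷ nil         e = cons e nil
  snocʷ (cons e′ W) e = cons e′ (snocʷ W e)

  reverseʷ : (∀ {a b} → R a b → R b a) → ∀ {u v k} → Walk R u v k → Walk R v u k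
  reverseʷ R-sym nil        = nil
  reverseʷ R-sym (cons e W) = snocʷ (reverseʷ R-sym W) (R-sym e)

  walk-nonempty : ∀ {u v k} → u ≢ v → Walk R u v k → 0 < k
  walk-nonempty u≢v nil        = ⊥-elim (u≢v refl)
  walk-nonempty _   (cons _ _) = s≤s z≤n

  -- past the end of the walk, vertexAt stays at its last vertex
  vertexAt : ∀ {u v k} → Walk R u v k → ℕ → A
  vertexAt {u} nil        _       = u
  vertexAt {u} (cons e W) zero    = u
  vertexAt     (cons e W) (suc t) = vertexAt W t

  vertexAt-first : ∀ {u v k} (W : Walk R u v k) → vertexAt W 0 ≡ u
  vertexAt-first nil        = refl
  vertexAt-first (cons e W) = refl

  vertexAt-last : ∀ {u v k} (W : Walk R u v k) → vertexAt W k ≡ v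
  vertexAt-last nil        = refl
  vertexAt-last (cons e W) = vertexAt-last W

  vertexAt-step : ∀ {u v k} (W : Walk R u v k) t → t < k → R (vertexAt W t) (vertexAt W (suc t))
  vertexAt-step (cons e W) zero    _         = subst (R _) (sym (vertexAt-first W)) e
  vertexAt-step (cons e W) (suc t) (s≤s t<k) = vertexAt-step W t t<k

  takeʷ : ∀ {u v k} (W : Walk R u v k) t → t ≤ k → Walk R u (vertexAt W t) t
  takeʷ nil        zero    _         = nil
  takeʷ (cons e W) zero    _         = nil
  takeʷ (cons e W) (suc t) (s≤s t≤k) = cons e (takeʷ W t t≤k)

  dropʷ : ∀ {u v k} (W : Walk R u v k) t → t ≤ k → Walk R (vertexAt W t) v (k ∸ t)
  dropʷ nil        zero    _         = nil
  dropʷ (cons e W) zero    _         = cons e W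
  dropʷ (cons e W) (suc t) (s≤s t≤k) = dropʷ W t t≤k

module _ (G : Graph) where
  open Graph G using (Adj; adj?)

  walk? : ∀ u v k → Dec (Walk Adj u v k)
  walk? u v zero with u ≟ᶠ v
  ... | yes refl = yes nil
  ... | no u≢v   = no λ { nil → u≢v refl }
  walk? u v (suc k) with any? (λ w → adj? u w ×-dec walk? w v k)
  ... | yes (w , e , W) = yes (cons e W)
  ... | no ∄w           = no λ { (cons e W) → ∄w (_ , e , W) }

  shortestWalk : ∀ {u v k} → Walk Adj u v k → ∃[ d ] Dist G u v d
  shortestWalk {u} {v} {k} = <-rec (λ k → Walk Adj u v k → ∃[ d ] Dist G u v d) step k
    where
    step : ∀ k → (∀ {j} → j < k → Walk Adj u v j → ∃[ d ] Dist G u v d) →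
           Walk Adj u v k → ∃[ d ] Dist G u v d
    step k shorter W with anyUpTo? (walk? u v) k
    ... | yes (j , j<k , W′) = shorter j<k W′
    ... | no ∄shorter        = k , W , λ j W′ → ≮⇒≥ λ j<k → ∄shorter (j , j<k , W′)

module Cyclic (g : ℕ) .{{_ : NonZero g}} where

  [m%g+n]%g≡[m+n]%g : ∀ m n → (m % g + n) % g ≡ (m + n) % g
  [m%g+n]%g≡[m+n]%g m n = begin
    (m % g + n) % g         ≡⟨ %-distribˡ-+ (m % g) n g ⟩
    (m % g % g + n % g) % g ≡⟨ cong (λ r → (r + n % g) % g) (m%n%n≡m%n m g) ⟩
    (m % g + n % g) % g     ≡⟨ %-distribˡ-+ m n g ⟨
    (m + n) % g             ∎
    where open ≡-Reasoning

  [1+m]%g≡[1+m%g]%g : ∀ m → suc m % g ≡ suc (m % g) % g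
  [1+m]%g≡[1+m%g]%g m = begin
    suc m % g       ≡⟨ cong (_% g) (+-comm 1 m) ⟩
    (m + 1) % g     ≡⟨ [m%g+n]%g≡[m+n]%g m 1 ⟨
    (m % g + 1) % g ≡⟨ cong (_% g) (+-comm (m % g) 1) ⟩
    suc (m % g) % g ∎
    where open ≡-Reasoning

  [[q+n]%g+[g∸q%g]]%g≡n%g : ∀ q n → ((q + n) % g + (g ∸ q % g)) % g ≡ n % g
  [[q+n]%g+[g∸q%g]]%g≡n%g q n = begin
    ((q + n) % g + (g ∸ q % g)) % g     ≡⟨ cong (λ r → (r + (g ∸ q % g)) % g) ([m%g+n]%g≡[m+n]%g q n) ⟨
    ((q % g + n) % g + (g ∸ q % g)) % g ≡⟨ [m%g+n]%g≡[m+n]%g (q % g + n) (g ∸ q % g) ⟩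
    (q % g + n + (g ∸ q % g)) % g       ≡⟨ cong (_% g) (+-comm (q % g + n) _) ⟩
    ((g ∸ q % g) + (q % g + n)) % g     ≡⟨ cong (_% g) (+-assoc (g ∸ q % g) (q % g) n) ⟨
    ((g ∸ q % g) + q % g + n) % g       ≡⟨ cong (λ r → (r + n) % g) (m∸n+n≡m (<⇒≤ (m%n<n q g))) ⟩
    (g + n) % g                         ≡⟨ cong (_% g) (+-comm g n) ⟩
    (n + g) % g                         ≡⟨ [m+n]%n≡m%n n g ⟩
    n % g                               ∎
    where open ≡-Reasoning

  +-cancelˡ-% : ∀ q {m n} → (q + m) % g ≡ (q + n) % g → m % g ≡ n % g
  +-cancelˡ-% q {m} {n} eq = begin
    m % g                               ≡⟨ [[q+n]%g+[g∸q%g]]%g≡n%g q m ⟨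
    ((q + m) % g + (g ∸ q % g)) % g     ≡⟨ cong (λ r → (r + (g ∸ q % g)) % g) eq ⟩
    ((q + n) % g + (g ∸ q % g)) % g     ≡⟨ [[q+n]%g+[g∸q%g]]%g≡n%g q n ⟩
    n % g                               ∎
    where open ≡-Reasoning

  shorterArc : ℕ → ℕ
  shorterArc D = D ⊓ (g ∸ D)

  shorterArc-complement : ∀ {D} → D ≤ g → shorterArc (g ∸ D) ≡ shorterArc D
  shorterArc-complement {D} D≤g = trans (cong ((g ∸ D) ⊓_) (m∸[m∸n]≡n D≤g)) (⊓-comm (g ∸ D) D)

  -- the number of forward steps from position α to position β
  offset : ℕ → ℕ → ℕ
  offset α β = (β + (g ∸ α)) % g

  offset<g : ∀ α β → offset α β < g
  offset<g α β = m%n<n (β + (g ∸ α)) g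

  offset-correct : ∀ {α} β → α < g → (α + offset α β) % g ≡ β % g
  offset-correct {α} β α<g = begin
    (α + (β + (g ∸ α)) % g) % g ≡⟨ cong (_% g) (+-comm α _) ⟩
    ((β + (g ∸ α)) % g + α) % g ≡⟨ [m%g+n]%g≡[m+n]%g (β + (g ∸ α)) α ⟩
    (β + (g ∸ α) + α) % g       ≡⟨ cong (_% g) (+-assoc β (g ∸ α) α) ⟩
    (β + ((g ∸ α) + α)) % g     ≡⟨ cong (λ n → (β + n) % g) (m∸n+n≡m (<⇒≤ α<g)) ⟩
    (β + g) % g                 ≡⟨ [m+n]%n≡m%n β g ⟩
    β % g                       ∎
    where open ≡-Reasoning

  offset-+ : ∀ A {D} → D < g → offset (A % g) ((A + D) % g) ≡ D
  offset-+ A {D} D<g = trans ([[q+n]%g+[g∸q%g]]%g≡n%g A D) (m<n⇒m%n≡m D<g)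

  cyclicDist : ℕ → ℕ → ℕ
  cyclicDist α β = shorterArc (offset α β)

  offset-self : ∀ {α} → α < g → offset α α ≡ 0
  offset-self α<g = trans (cong (_% g) (m+[n∸m]≡n (<⇒≤ α<g))) (n%n≡0 g)

  cyclicDist-self : ∀ {α} → α < g → cyclicDist α α ≡ 0
  cyclicDist-self α<g = cong shorterArc (offset-self α<g)

  shorterArc-suc-≥ : ∀ {e δ} → δ ≤ 1 → e + δ + suc e ≤ g → e + δ ≤ shorterArc (suc e)
  shorterArc-suc-≥ {e} {δ} δ≤1 fits =
    ⊓-glb (≤-trans (+-monoʳ-≤ e δ≤1) (≤-reflexive (+-comm e 1))) (m+n≤o⇒m≤o∸n (e + δ) fits)

  private
    m∸n≡1+[m∸1+n] : ∀ {m n} → n < m → m ∸ n ≡ suc (m ∸ suc n)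
    m∸n≡1+[m∸1+n] = +-∸-assoc 1

    ⊓-shiftʳ : ∀ a b → a ⊓ suc b ≤ suc (suc a ⊓ b)
    ⊓-shiftʳ a b = ≤-trans (⊓-monoˡ-≤ (suc b) (n≤1+n a)) (s≤s (⊓-monoˡ-≤ b (n≤1+n a)))

    ⊓-shiftˡ : ∀ a b → suc a ⊓ b ≤ suc (a ⊓ suc b)
    ⊓-shiftˡ a b = ≤-trans (⊓-monoʳ-≤ (suc a) (n≤1+n b)) (s≤s (⊓-monoʳ-≤ a (n≤1+n b)))

  shorterArc-suc : ∀ n → shorterArc (n % g) ≤ suc (shorterArc (suc n % g))
                       × shorterArc (suc n % g) ≤ suc (shorterArc (n % g))
  shorterArc-suc n rewrite [1+m]%g≡[1+m%g]%g n with suc (n % g) <? g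
  ... | yes 1+r<g rewrite m<n⇒m%n≡m 1+r<g | m∸n≡1+[m∸1+n] (m%n<n n g) =
    ⊓-shiftʳ (n % g) (g ∸ suc (n % g)) , ⊓-shiftˡ (n % g) (g ∸ suc (n % g))
  ... | no 1+r≮g = subst (λ r → shorterArc (n % g) ≤ suc (shorterArc (r % g))) (sym 1+r≡g) r-near-g
                 , subst (λ r → shorterArc (r % g) ≤ suc (shorterArc (n % g))) (sym 1+r≡g)
                     (subst (λ r → shorterArc r ≤ suc (shorterArc (n % g))) (sym (n%n≡0 g)) z≤n)
    where
    1+r≡g : suc (n % g) ≡ g
    1+r≡g = ≤-antisym (m%n<n n g) (≮⇒≥ 1+r≮g)
    r-near-g : shorterArc (n % g) ≤ suc (shorterArc (g % g))
    r-near-g = ≤-trans (m⊓n≤n (n % g) (g ∸ n % g))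
                 (≤-trans (≤-reflexive (trans (cong (_∸ n % g) (sym 1+r≡g)) (m+n∸n≡m 1 (n % g))))
                          (s≤s z≤n))

  cyclicDist-suc : ∀ α j → cyclicDist α (j % g) ≤ suc (cyclicDist α (suc j % g))
                         × cyclicDist α (suc j % g) ≤ suc (cyclicDist α (j % g))
  cyclicDist-suc α j rewrite [m%g+n]%g≡[m+n]%g j (g ∸ α) | [m%g+n]%g≡[m+n]%g (suc j) (g ∸ α) =
    shorterArc-suc (j + (g ∸ α))

module CycleGeometry {G : Graph} (C : Cycle G) where
  open Graph G using (Adj)
  open Cyclic (g C) public

  toℕ-mod : ∀ j → toℕ (j mod g C) ≡ j % g C
  toℕ-mod j = toℕ-fromℕ< (m%n<n j (g C))

  at-cong : ∀ a b → a % g C ≡ b % g C → at C a ≡ at C b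
  at-cong a b eq = cong (vtx C) (toℕ-injective (trans (toℕ-mod a) (trans eq (sym (toℕ-mod b)))))

  at-injective : ∀ a b → at C a ≡ at C b → a % g C ≡ b % g C
  at-injective a b eq = trans (sym (toℕ-mod a)) (trans (cong toℕ (vtx-inj C eq)) (toℕ-mod b))

  toℕ%g≡toℕ : ∀ (c : Fin (g C)) → toℕ c % g C ≡ toℕ c
  toℕ%g≡toℕ c = m<n⇒m%n≡m (toℕ<n c)

  vtx≡at : ∀ c → vtx C c ≡ at C (toℕ c)
  vtx≡at c = cong (vtx C) (toℕ-injective (sym (trans (toℕ-mod (toℕ c)) (toℕ%g≡toℕ c))))

  toℕ-position : ∀ {c A} → vtx C c ≡ at C A → toℕ c ≡ A % g C
  toℕ-position {c} {A} c≡A =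
    trans (sym (toℕ%g≡toℕ c)) (at-injective (toℕ c) A (trans (sym (vtx≡at c)) c≡A))

  at-onCycle : ∀ j → OnCycle C (at C j)
  at-onCycle j = j mod g C , refl

  at-+-injective : ∀ q {u w} → at C (q + u) ≡ at C (q + w) → u < g C → w < g C → u ≡ w
  at-+-injective q {u} {w} eq u<g w<g = begin
    u       ≡⟨ m<n⇒m%n≡m u<g ⟨
    u % g C ≡⟨ +-cancelˡ-% q (at-injective (q + u) (q + w) eq) ⟩
    w % g C ≡⟨ m<n⇒m%n≡m w<g ⟩
    w       ∎
    where open ≡-Reasoning

  arcWalk : ∀ j d → Walk Adj (at C j) (at C (j + d)) d
  arcWalk j zero    = subst (λ i → Walk Adj (at C j) (at C i) 0) (sym (+-identityʳ j)) nil
  arcWalk j (suc d) = cons (vtx-adj C j)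
    (subst (λ i → Walk Adj (at C (suc j)) (at C i) d) (sym (+-suc j d)) (arcWalk (suc j) d))

  onCycle? : ∀ u → Dec (OnCycle C u)
  onCycle? u = any? (λ i → u ≟ᶠ vtx C i)

  CycEdge⇒OnCycle : ∀ {u w} → CycEdge C u w → OnCycle C u
  CycEdge⇒OnCycle (j , inj₁ (u≡ , _)) = j mod g C , u≡
  CycEdge⇒OnCycle (j , inj₂ (_ , u≡)) = suc j mod g C , u≡

  CycEdge⇒Adj : ∀ {u w} → CycEdge C u w → Adj u w
  CycEdge⇒Adj (j , inj₁ (u≡ , w≡)) = subst₂ Adj (sym u≡) (sym w≡) (vtx-adj C j)
  CycEdge⇒Adj (j , inj₂ (w≡ , u≡)) = Graph.sym G (subst₂ Adj (sym w≡) (sym u≡) (vtx-adj C j))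

  CycEdge-sym : ∀ {u w} → CycEdge C u w → CycEdge C w u
  CycEdge-sym (j , inj₁ (u≡ , w≡)) = j , inj₂ (u≡ , w≡)
  CycEdge-sym (j , inj₂ (w≡ , u≡)) = j , inj₁ (w≡ , u≡)

  cycEdge? : ∀ u w → Dec (CycEdge C u w)
  cycEdge? u w = map′ (λ (i , e) → toℕ i , e) (λ (j , e) → j mod g C , reduce j e)
                      (any? (λ i → edgeAt? (toℕ i)))
    where
    EdgeAt : ℕ → Set
    EdgeAt j = (u ≡ at C j × w ≡ at C (suc j)) ⊎ (w ≡ at C j × u ≡ at C (suc j))

    edgeAt? : ∀ j → Dec (EdgeAt j)
    edgeAt? j = ((u ≟ᶠ at C j) ×-dec (w ≟ᶠ at C (suc j)))
            ⊎-dec ((w ≟ᶠ at C j) ×-dec (u ≟ᶠ at C (suc j)))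

    reduce : ∀ j → EdgeAt j → EdgeAt (toℕ (j mod g C))
    reduce j e rewrite toℕ-mod j with at-cong (j % g C) j (m%n%n≡m%n j (g C))
                                    | at-cong (suc (j % g C)) (suc j) (sym ([1+m]%g≡[1+m%g]%g j))
    ... | at≡ | at-suc≡ with e
    ...   | inj₁ (u≡ , w≡) = inj₁ (trans u≡ (sym at≡) , trans w≡ (sym at-suc≡))
    ...   | inj₂ (w≡ , u≡) = inj₂ (trans w≡ (sym at≡) , trans u≡ (sym at-suc≡))

module ClosedSequence {G : Graph} (len : ℕ) (f : ℕ → V G)
  (f-injective : ∀ {t₁ t₂} → t₁ < 3 + len → t₂ < 3 + len → f t₁ ≡ f t₂ → t₁ ≡ t₂)
  (f-adj : ∀ t → suc t < 3 + len → Graph.Adj G (f t) (f (suc t)))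
  (f-close : Graph.Adj G (f (2 + len)) (f 0)) where

  open Graph G using (Adj)

  private
    f-mod : ∀ {t} → t < 3 + len → f (toℕ (t mod (3 + len))) ≡ f t
    f-mod t<N = cong f (trans (toℕ-fromℕ< _) (m<n⇒m%n≡m t<N))

    adj-mod : ∀ j → Adj (f (toℕ (j mod (3 + len)))) (f (toℕ (suc j mod (3 + len))))
    adj-mod j rewrite toℕ-fromℕ< (m%n<n j (3 + len)) | toℕ-fromℕ< (m%n<n (suc j) (3 + len))
                    | Cyclic.[1+m]%g≡[1+m%g]%g (3 + len) j
      with suc (j % (3 + len)) <? 3 + len
    ... | yes 1+r<N rewrite m<n⇒m%n≡m 1+r<N = f-adj (j % (3 + len)) 1+r<N
    ... | no 1+r≮N = subst₂ Adj (cong f (sym (suc-injective 1+r≡N)))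
                                (cong f (sym (trans (cong (_% (3 + len)) 1+r≡N) (n%n≡0 (3 + len)))))
                                f-close
      where
      1+r≡N : suc (j % (3 + len)) ≡ 3 + len
      1+r≡N = ≤-antisym (m%n<n j (3 + len)) (≮⇒≥ 1+r≮N)

  cycleOf : Cycle G
  cycleOf = record
    { m       = len
    ; vtx     = λ i → f (toℕ i)
    ; vtx-inj = λ {i} {j} eq → toℕ-injective (f-injective (toℕ<n i) (toℕ<n j) eq)
    ; vtx-adj = adj-mod
    }

  cycleOf-edge : ∀ t → suc t < 3 + len → CycEdge cycleOf (f t) (f (suc t))
  cycleOf-edge t 1+t<N = t , inj₁ (sym (f-mod (<-trans (n<1+n t) 1+t<N)) , sym (f-mod 1+t<N))

  cycleOf-closingEdge : CycEdge cycleOf (f (2 + len)) (f 0)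
  cycleOf-closingEdge =
    2 + len , inj₁ (sym (f-mod ≤-refl) , sym (cong f (trans (toℕ-fromℕ< _) (n%n≡0 (3 + len)))))

CyclesEdgeDisjoint : Graph → Set
CyclesEdgeDisjoint G = ∀ (C D : Cycle G) → ¬ SameCycle G C D → ∀ u w → CycEdge C u w → ¬ CycEdge D u w

-- A path p from at C (β + D) to at C β through G − E(C), meeting C only at its ends, closes up with
-- the arc of C from β to β + D into a second cycle, which shares the edge ending at at C (β + D) with C.
module DetourCycle {G : Graph} (C : Cycle G) {k : ℕ} (p : ℕ → V G) (β D : ℕ)
  (0<k : 0 < k) (0<D : 0 < D) (D<g : D < g C)
  (p-adj : ∀ t → t < k → AdjOff G C (p t) (p (suc t)))
  (p-injective : ∀ {t₁ t₂} → t₁ ≤ k → t₂ ≤ k → p t₁ ≡ p t₂ → t₁ ≡ t₂)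
  (p-off : ∀ t → 0 < t → t < k → ¬ OnCycle C (p t))
  (p-first : p 0 ≡ at C (β + D)) (p-last : p k ≡ at C β) where

  open Graph G using (Adj)
  open CycleGeometry C

  private
    both-one : ∀ {a b} → 0 < a → 0 < b → ¬ 3 ≤ a + b → a ≡ 1 × b ≡ 1
    both-one {suc zero}    {suc zero}    _ _ _ = refl , refl
    both-one {suc zero}    {suc (suc b)} _ _ h = ⊥-elim (h (s≤s (s≤s (s≤s z≤n))))
    both-one {suc (suc a)} {suc b}       _ _ h =
      ⊥-elim (h (s≤s (s≤s (≤-trans (s≤s z≤n) (m≤n+m (suc b) a)))))

  module Closure (3≤k+D : 3 ≤ k + D) where

    len : ℕ
    len = k + D ∸ 3

    N≡k+D : 3 + len ≡ k + D
    N≡k+D = m+[n∸m]≡n 3≤k+D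

    opaque
      f : ℕ → V G
      f t with t <? k
      ... | yes _ = p t
      ... | no  _ = at C (β + (t ∸ k))

      f-path : ∀ {t} → t < k → f t ≡ p t
      f-path {t} t<k with t <? k
      ... | yes _  = refl
      ... | no t≮k = ⊥-elim (t≮k t<k)

      f-arc : ∀ {t} → k ≤ t → f t ≡ at C (β + (t ∸ k))
      f-arc {t} k≤t with t <? k
      ... | yes t<k = ⊥-elim (<⇒≱ t<k k≤t)
      ... | no  _   = refl

    arcOffset<D : ∀ {t} → k ≤ t → t < 3 + len → t ∸ k < D
    arcOffset<D {t} k≤t t<N = subst (t ∸ k <_) (m+n∸m≡n k D) (∸-monoˡ-< (subst (t <_) N≡k+D t<N) k≤t)

    arcOffset<g : ∀ {t} → k ≤ t → t < 3 + len → t ∸ k < g C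
    arcOffset<g k≤t t<N = <-trans (arcOffset<D k≤t t<N) D<g

    path≢arc : ∀ {t₁ t₂} → t₁ < k → k ≤ t₂ → t₂ < 3 + len → f t₁ ≢ f t₂
    path≢arc {zero} {t₂} 0<k k≤t₂ t₂<N eq = <-irrefl (sym D≡offset) (arcOffset<D k≤t₂ t₂<N)
      where
      D≡offset : D ≡ t₂ ∸ k
      D≡offset = at-+-injective β (trans (sym p-first) (trans (sym (f-path 0<k)) (trans eq (f-arc k≤t₂))))
                   D<g (arcOffset<g k≤t₂ t₂<N)
    path≢arc {suc t} {t₂} t<k k≤t₂ _ eq =
      p-off (suc t) (s≤s z≤n) t<k (subst (OnCycle C) (sym (trans (sym (f-path t<k)) (trans eq (f-arc k≤t₂))))
                                      (at-onCycle (β + (t₂ ∸ k))))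

    f-injective : ∀ {t₁ t₂} → t₁ < 3 + len → t₂ < 3 + len → f t₁ ≡ f t₂ → t₁ ≡ t₂
    f-injective {t₁} {t₂} t₁<N t₂<N eq with t₁ <? k | t₂ <? k
    ... | yes t₁<k | yes t₂<k =
      p-injective (<⇒≤ t₁<k) (<⇒≤ t₂<k) (trans (sym (f-path t₁<k)) (trans eq (f-path t₂<k)))
    ... | yes t₁<k | no t₂≮k  = ⊥-elim (path≢arc t₁<k (≮⇒≥ t₂≮k) t₂<N eq)
    ... | no t₁≮k  | yes t₂<k = ⊥-elim (path≢arc t₂<k (≮⇒≥ t₁≮k) t₁<N (sym eq))
    ... | no t₁≮k  | no t₂≮k  = ∸-cancelʳ-≡ (≮⇒≥ t₁≮k) (≮⇒≥ t₂≮k)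
      (at-+-injective β (trans (sym (f-arc (≮⇒≥ t₁≮k))) (trans eq (f-arc (≮⇒≥ t₂≮k))))
        (arcOffset<g (≮⇒≥ t₁≮k) t₁<N) (arcOffset<g (≮⇒≥ t₂≮k) t₂<N))

    f-k : f k ≡ p k
    f-k = trans (f-arc ≤-refl) (trans (cong (λ i → at C (β + i)) (n∸n≡0 k))
                 (trans (cong (at C) (+-identityʳ β)) (sym p-last)))

    f-adj : ∀ t → suc t < 3 + len → Adj (f t) (f (suc t))
    f-adj t _ with <-cmp (suc t) k
    ... | tri< 1+t<k _ _ = subst₂ Adj (sym (f-path (<-trans (n<1+n t) 1+t<k))) (sym (f-path 1+t<k))
                                      (proj₁ (p-adj t (<-trans (n<1+n t) 1+t<k)))
    ... | tri≈ _ refl _  = subst₂ Adj (sym (f-path ≤-refl)) (sym f-k) (proj₁ (p-adj t ≤-refl))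
    ... | tri> _ _ k<1+t = subst₂ Adj (sym (f-arc k≤t)) (sym (trans (f-arc (≤-trans k≤t (n≤1+n t))) arc-suc))
                                      (vtx-adj C (β + (t ∸ k)))
      where
      k≤t : k ≤ t
      k≤t = ≤-pred k<1+t
      arc-suc : at C (β + (suc t ∸ k)) ≡ at C (suc (β + (t ∸ k)))
      arc-suc = cong (at C) (trans (cong (β +_) (+-∸-assoc 1 k≤t)) (+-suc β (t ∸ k)))

    k≤2+len : k ≤ 2 + len
    k≤2+len = ≤-pred (subst (k <_) (sym N≡k+D) (subst (_≤ k + D) (+-comm k 1) (+-monoʳ-≤ k 0<D)))

    closingArc : suc (β + (2 + len ∸ k)) ≡ β + D
    closingArc = begin
      suc (β + (2 + len ∸ k)) ≡⟨ +-suc β _ ⟨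
      β + suc (2 + len ∸ k)   ≡⟨ cong (β +_) (+-∸-assoc 1 k≤2+len) ⟨
      β + (3 + len ∸ k)       ≡⟨ cong (λ n → β + (n ∸ k)) N≡k+D ⟩
      β + (k + D ∸ k)         ≡⟨ cong (β +_) (m+n∸m≡n k D) ⟩
      β + D                   ∎
      where open ≡-Reasoning

    f-last≡ : f (2 + len) ≡ at C (β + (2 + len ∸ k))
    f-last≡ = f-arc k≤2+len

    f-0≡ : f 0 ≡ at C (suc (β + (2 + len ∸ k)))
    f-0≡ = trans (f-path 0<k) (trans p-first (cong (at C) (sym closingArc)))

    f-close : Adj (f (2 + len)) (f 0)
    f-close = subst₂ Adj (sym f-last≡) (sym f-0≡) (vtx-adj C (β + (2 + len ∸ k)))

    open ClosedSequence {G} len f f-injective f-adj f-close public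

    f-1 : f 1 ≡ p 1
    f-1 with 1 <? k
    ... | yes 1<k = f-path 1<k
    ... | no 1≮k  = subst (λ k′ → f k′ ≡ p k′) (≤-antisym (≮⇒≥ 1≮k) 0<k) f-k

    cycleOf≢C : ¬ SameCycle G C cycleOf
    cycleOf≢C same = proj₂ (p-adj 0 0<k) (proj₂ (same (p 0) (p 1))
      (subst₂ (CycEdge cycleOf) (f-path 0<k) f-1 (cycleOf-edge 0 (s≤s (s≤s z≤n)))))

    closingEdge-on-C : CycEdge C (f (2 + len)) (f 0)
    closingEdge-on-C = β + (2 + len ∸ k) , inj₁ (f-last≡ , f-0≡)

  detour-absurd : CyclesEdgeDisjoint G → ⊥
  detour-absurd disjoint with 3 ≤? k + D
  ... | yes 3≤k+D = disjoint C cycleOf cycleOf≢C _ _ closingEdge-on-C cycleOf-closingEdge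
    where open Closure 3≤k+D
  ... | no 3≰k+D with both-one 0<k 0<D 3≰k+D
  -- k = D = 1: p is a single edge between consecutive vertices of C, i.e. an edge of C
  ...   | refl , refl = proj₂ (p-adj 0 0<k) (β , inj₂ (p-last , trans p-first (cong (at C) (+-comm β 1))))

module NoDetour {G : Graph} (C : Cycle G) (disjoint : CyclesEdgeDisjoint G) where
  open CycleGeometry C

  Detour : Fin (g C) → Fin (g C) → ℕ → Set
  Detour c c′ = Walk (AdjOff G C) (vtx C c) (vtx C c′)

  ShorterDetour : ℕ → Set
  ShorterDetour k = ∃[ c ] ∃[ c′ ] ∃[ j ] (j < k × c ≢ c′ × Detour c c′ j)

  module _ {c c′ : Fin (g C)} {k : ℕ} (c≢c′ : c ≢ c′) (W : Detour c c′ k) where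

    private
      p : ℕ → V G
      p = vertexAt W


    simpleDetour-absurd : (∀ t → 0 < t → t < k → ¬ OnCycle C (p t)) →
                          (∀ {t₁ t₂} → t₁ ≤ k → t₂ ≤ k → p t₁ ≡ p t₂ → t₁ ≡ t₂) → ⊥
    simpleDetour-absurd p-off p-injective =
      DetourCycle.detour-absurd C p β D 0<k 0<D (offset<g β α) (vertexAt-step W) p-injective p-off
        p-first p-last disjoint
      where
      α β D : ℕ
      α = toℕ c
      β = toℕ c′
      D = offset β α

      β+D≡α : (β + D) % g C ≡ α % g C
      β+D≡α = offset-correct α (toℕ<n c′)

      p-first : p 0 ≡ at C (β + D)
      p-first = trans (vertexAt-first W) (trans (vtx≡at c) (at-cong α (β + D) (sym β+D≡α)))

      p-last : p k ≡ at C β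
      p-last = trans (vertexAt-last W) (vtx≡at c′)

      0<k : 0 < k
      0<k = walk-nonempty (λ eq → c≢c′ (vtx-inj C eq)) W

      0<D : 0 < D
      0<D = n≢0⇒n>0 λ D≡0 → c≢c′ (toℕ-injective (begin
        α             ≡⟨ toℕ%g≡toℕ c ⟨
        α % g C       ≡⟨ β+D≡α ⟨
        (β + D) % g C ≡⟨ cong (λ n → (β + n) % g C) D≡0 ⟩
        (β + 0) % g C ≡⟨ cong (_% g C) (+-identityʳ β) ⟩
        β % g C       ≡⟨ toℕ%g≡toℕ c′ ⟩
        β             ∎))
        where open ≡-Reasoning

    shortcut-via-C : ∀ {t} → t < k → 0 < t → OnCycle C (p t) → ShorterDetour k
    shortcut-via-C {t} t<k 0<t (e , pt≡e) with e ≟ᶠ c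
    ... | no e≢c   = c , e , t , t<k , (λ c≡e → e≢c (sym c≡e))
                   , subst (λ x → Walk (AdjOff G C) (vtx C c) x t) pt≡e (takeʷ W t (<⇒≤ t<k))
    ... | yes refl = c , c′ , k ∸ t , ∸-monoʳ-< 0<t (<⇒≤ t<k) , c≢c′
                   , subst (λ x → Walk (AdjOff G C) x (vtx C c′) (k ∸ t)) pt≡e (dropʷ W t (<⇒≤ t<k))

    shortcut-at-repeat : ∀ {t₁ t₂} → t₁ < t₂ → t₂ ≤ k → p t₁ ≡ p t₂ → ShorterDetour k
    shortcut-at-repeat {t₁} {t₂} t₁<t₂ t₂≤k pt₁≡pt₂ = c , c′ , t₁ + (k ∸ t₂) , shorter , c≢c′
      , takeʷ W t₁ (<⇒≤ (<-≤-trans t₁<t₂ t₂≤k))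
        ++ʷ subst (λ x → Walk (AdjOff G C) x (vtx C c′) (k ∸ t₂)) (sym pt₁≡pt₂) (dropʷ W t₂ t₂≤k)
      where
      shorter : t₁ + (k ∸ t₂) < k
      shorter = subst (t₁ + (k ∸ t₂) <_) (m+[n∸m]≡n t₂≤k) (+-monoˡ-< (k ∸ t₂) t₁<t₂)

    shorten : ShorterDetour k
    shorten with anyUpTo? (λ t → (0 <? t) ×-dec onCycle? (p t)) k
    ... | yes (t , t<k , 0<t , on) = shortcut-via-C t<k 0<t on
    ... | no ∄on with anyUpTo? (λ t₂ → anyUpTo? (λ t₁ → p t₁ ≟ᶠ p t₂) t₂) (suc k)
    ...   | yes (t₂ , s≤s t₂≤k , t₁ , t₁<t₂ , eq) = shortcut-at-repeat t₁<t₂ t₂≤k eq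
    ...   | no ∄repeat = ⊥-elim (simpleDetour-absurd p-off p-injective)
      where
      p-off : ∀ t → 0 < t → t < k → ¬ OnCycle C (p t)
      p-off t 0<t t<k on = ∄on (t , t<k , 0<t , on)

      p-injective : ∀ {t₁ t₂} → t₁ ≤ k → t₂ ≤ k → p t₁ ≡ p t₂ → t₁ ≡ t₂
      p-injective {t₁} {t₂} t₁≤k t₂≤k eq with <-cmp t₁ t₂
      ... | tri< t₁<t₂ _ _ = ⊥-elim (∄repeat (t₂ , s≤s t₂≤k , t₁ , t₁<t₂ , eq))
      ... | tri≈ _ t₁≡t₂ _ = t₁≡t₂
      ... | tri> _ _ t₂<t₁ = ⊥-elim (∄repeat (t₁ , s≤s t₁≤k , t₂ , t₂<t₁ , sym eq))

  noDetour : ∀ {c c′ k} → c ≢ c′ → ¬ Detour c c′ k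
  noDetour {k = k} = <-rec (λ k → ∀ {c c′} → c ≢ c′ → ¬ Detour c c′ k) step k
    where
    step : ∀ k → (∀ {j} → j < k → ∀ {c c′} → c ≢ c′ → ¬ Detour c c′ j) →
           ∀ {c c′} → c ≢ c′ → ¬ Detour c c′ k
    step k noShorter c≢c′ W with shorten c≢c′ W
    ... | _ , _ , _ , j<k , d≢d′ , W′ = noShorter j<k d≢d′ W′

module Attachment {G : Graph} (C : Cycle G) (disjoint : CyclesEdgeDisjoint G) where
  open Graph G using (Adj) renaming (sym to Adj-sym)
  open CycleGeometry C
  open NoDetour C disjoint

  AttachedAt : Fin (g C) → V G → Set
  AttachedAt c = InT G C (vtx C c)

  AdjOff-sym : ∀ {u w} → AdjOff G C u w → AdjOff G C w u
  AdjOff-sym (u~w , ¬uw∈C) = Adj-sym u~w , λ wu∈C → ¬uw∈C (CycEdge-sym wu∈C)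

  attachedAt-unique : ∀ {u c c′} → AttachedAt c u → AttachedAt c′ u → c ≡ c′
  attachedAt-unique {c = c} {c′} (_ , W) (_ , W′) with c ≟ᶠ c′
  ... | yes c≡c′ = c≡c′
  ... | no c≢c′  = ⊥-elim (noDetour c≢c′ (W ++ʷ reverseʷ AdjOff-sym W′))

  attachedAt-self : ∀ {u} c → u ≡ vtx C c → AttachedAt c u
  attachedAt-self c refl = 0 , nil

  attachedAt-step : ∀ {c u w} → AttachedAt c u → AdjOff G C u w → AttachedAt c w
  attachedAt-step (_ , W) e = _ , snocʷ W e

  onCycle⇒attached : ∀ {u} → OnCycle C u → ∃ λ c → AttachedAt c u
  onCycle⇒attached (c , u≡c) = c , attachedAt-self c u≡c

  attachedAt-along : ∀ {u w k} → Walk Adj u w k → ∃ (λ c → AttachedAt c u) → ∃ (λ c → AttachedAt c w)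
  attachedAt-along nil a = a
  attachedAt-along {u} (cons {w = w} e W) (c , a) with cycEdge? u w
  ... | no ¬uw∈C = attachedAt-along W (c , attachedAt-step a (e , ¬uw∈C))
  ... | yes uw∈C = attachedAt-along W (onCycle⇒attached (CycEdge⇒OnCycle (CycEdge-sym uw∈C)))

  module _ (α : ℕ) where

    cycEdge-attachedAt-dist : ∀ {u w c c′} → CycEdge C u w → AttachedAt c u → AttachedAt c′ w →
                              cyclicDist α (toℕ c′) ≤ suc (cyclicDist α (toℕ c))
    cycEdge-attachedAt-dist (j , inj₁ (u≡ , w≡)) a a′
      rewrite attachedAt-unique a (attachedAt-self (j mod g C) u≡)
            | attachedAt-unique a′ (attachedAt-self (suc j mod g C) w≡)
            | toℕ-mod j | toℕ-mod (suc j) = proj₂ (cyclicDist-suc α j)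
    cycEdge-attachedAt-dist (j , inj₂ (w≡ , u≡)) a a′
      rewrite attachedAt-unique a (attachedAt-self (suc j mod g C) u≡)
            | attachedAt-unique a′ (attachedAt-self (j mod g C) w≡)
            | toℕ-mod j | toℕ-mod (suc j) = proj₁ (cyclicDist-suc α j)

    walk-attachedAt-dist : ∀ {u w m c c′} → Walk Adj u w m → AttachedAt c u → AttachedAt c′ w →
                           cyclicDist α (toℕ c′) ≤ cyclicDist α (toℕ c) + m
    walk-attachedAt-dist nil a a′ rewrite attachedAt-unique a a′ = m≤m+n _ 0
    walk-attachedAt-dist {u} {m = suc m} {c} {c′} (cons {w = w} e W) a a′ with cycEdge? u w
    ... | no ¬uw∈C = ≤-trans (walk-attachedAt-dist W (attachedAt-step a (e , ¬uw∈C)) a′)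
                             (+-monoʳ-≤ (cyclicDist α (toℕ c)) (n≤1+n m))
    ... | yes uw∈C with onCycle⇒attached (CycEdge⇒OnCycle (CycEdge-sym uw∈C))
    ...   | (i , aw) = begin
      cyclicDist α (toℕ c′)         ≤⟨ walk-attachedAt-dist W aw a′ ⟩
      cyclicDist α (toℕ i) + m       ≤⟨ +-monoˡ-≤ m (cycEdge-attachedAt-dist uw∈C a aw) ⟩
      suc (cyclicDist α (toℕ c)) + m ≡⟨ +-suc (cyclicDist α (toℕ c)) m ⟨
      cyclicDist α (toℕ c) + suc m   ∎
      where open ≤-Reasoning

  walk-enters-C-at : ∀ {u w m c c′} → Walk Adj u w m → AttachedAt c u → AttachedAt c′ w → c ≢ c′ →
                     ∃[ k ] (Walk Adj u (vtx C c) k × k + cyclicDist (toℕ c) (toℕ c′) ≤ m)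
  walk-enters-C-at nil a a′ c≢c′ = ⊥-elim (c≢c′ (attachedAt-unique a a′))
  walk-enters-C-at {u} (cons {w = w} e W) a a′ c≢c′ with cycEdge? u w
  ... | no ¬uw∈C with walk-enters-C-at W (attachedAt-step a (e , ¬uw∈C)) a′ c≢c′
  ...   | k , W′ , k+d≤m = suc k , cons e W′ , s≤s k+d≤m
  walk-enters-C-at {u} {m = suc m} {c′ = c′} (cons e W) a a′ c≢c′ | yes uw∈C
    with CycEdge⇒OnCycle uw∈C
  ... | i , u≡i rewrite attachedAt-unique a (attachedAt-self i u≡i) =
    0 , subst (λ x → Walk Adj u x 0) u≡i nil ,
    subst (λ d → cyclicDist (toℕ i) (toℕ c′) ≤ d + suc m) (cyclicDist-self (toℕ<n i))
      (walk-attachedAt-dist (toℕ i) (cons e W) (attachedAt-self i u≡i) a′)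

GapNeighbour : (G : Graph) → Subset (Graph.n G) → ℕ → Cycle G → V G → Set
GapNeighbour G S δ C v = ∃[ x ] (CycEdge C v x ×
  (∀ {s d m} → s ∈ S → Dist G s v d → Walk (Graph.Adj G) s x m → d + δ ≤ m))

module SPathEnds {G : Graph} (C : Cycle G) (disjoint : CyclesEdgeDisjoint G) (connected : Connected G)
                 (S : Subset (Graph.n G)) where
  open Graph G using (Adj) renaming (sym to Adj-sym)
  open CycleGeometry C
  open Attachment C disjoint

  Behind : ℕ → V G → Fin (g C) → Fin (g C) → Set
  Behind δ v x c = c ≢ x × ∃[ e ] (Walk Adj (vtx C c) v e × e + δ ≤ cyclicDist (toℕ c) (toℕ x))

  LiesBeyond : ℕ → V G → Fin (g C) → Set
  LiesBeyond δ v x = ∀ c → Active G S C (vtx C c) → Behind δ v x c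

  -- every walk from s to vtx C x passes the attachment vertex of s, which is S-active
  liesBeyond⇒gap : ∀ {δ v x} → OnCycle C v → LiesBeyond δ v x →
                   ∀ {s d m} → s ∈ S → Dist G s v d → Walk Adj s (vtx C x) m → d + δ ≤ m
  liesBeyond⇒gap {δ} {v} {x} v∈C beyond {s} {d} {m} s∈S (_ , shortest) W
    with attachedAt-along (proj₂ (connected v s)) (onCycle⇒attached v∈C)
  ... | c , s∈Tc with beyond c ((c , refl) , s , s∈S , s∈Tc)
  ...   | c≢x , e , W-out , e+δ≤ with walk-enters-C-at W s∈Tc (attachedAt-self x refl) c≢x
  ...     | k , W-in , k+dist≤m = begin
    d + δ                          ≤⟨ +-monoˡ-≤ δ (shortest (k + e) (W-in ++ʷ W-out)) ⟩
    k + e + δ                      ≡⟨ +-assoc k e δ ⟩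
    k + (e + δ)                    ≤⟨ +-monoʳ-≤ k e+δ≤ ⟩
    k + cyclicDist (toℕ c) (toℕ x) ≤⟨ k+dist≤m ⟩
    m                              ∎
    where open ≤-Reasoning

  apart : ∀ {c x} A D → vtx C c ≡ at C A → vtx C x ≡ at C (A + D) → 0 < D → D < g C →
          c ≢ x × cyclicDist (toℕ c) (toℕ x) ≡ shorterArc D
  apart {c} {x} A D c≡A x≡A+D 0<D D<g = c≢x , cong shorterArc offset≡D
    where
    offset≡D : offset (toℕ c) (toℕ x) ≡ D
    offset≡D = trans (cong₂ offset (toℕ-position {A = A} c≡A) (toℕ-position {A = A + D} x≡A+D))
                     (offset-+ A D<g)
    c≢x : c ≢ x
    c≢x refl = <⇒≢ 0<D (trans (sym (offset-self (toℕ<n c))) offset≡D)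

  module Ends {i : Fin (g C)} {ℓ δ : ℕ} (cov : Covers G S C i ℓ) (δ≤1 : δ ≤ 1)
           (fits : δ + (suc ℓ + suc ℓ) ≤ suc (g C)) where

    private
      I : ℕ
      I = toℕ i

      fits-below : ∀ {e} → e ≤ ℓ → e + δ + suc e ≤ g C
      fits-below {e} e≤ℓ = ≤-pred (begin
        suc (e + δ + suc e)  ≡⟨ reshape e δ ⟩
        δ + (suc e + suc e)  ≤⟨ +-monoʳ-≤ δ (+-mono-≤ (s≤s e≤ℓ) (s≤s e≤ℓ)) ⟩
        δ + (suc ℓ + suc ℓ)  ≤⟨ fits ⟩
        suc (g C)            ∎)
        where
        open ≤-Reasoning
        reshape : ∀ e δ → suc (e + δ + suc e) ≡ δ + (suc e + suc e)
        reshape = solve-∀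

      1+e<g : ∀ {e} → e ≤ ℓ → suc e < g C
      1+e<g {zero}   _    = s≤s (s≤s z≤n)
      1+e<g {suc e} e<ℓ = ≤-trans (+-monoˡ-≤ (suc (suc e)) (s≤s z≤n)) (fits-below e<ℓ)

      e+δ≤arc : ∀ {e} → e ≤ ℓ → e + δ ≤ shorterArc (suc e)
      e+δ≤arc e≤ℓ = shorterArc-suc-≥ δ≤1 (fits-below e≤ℓ)

    end-behind : ∀ {c t} → t ≤ ℓ → vtx C c ≡ at C (I + t) →
                 Behind δ (at C (I + ℓ)) ((I + suc ℓ) mod g C) c
    end-behind {c} {t} t≤ℓ c≡ = proj₁ arc , ℓ ∸ t
      , subst₂ (λ a b → Walk Adj a b (ℓ ∸ t)) (sym c≡) (cong (at C) I+t+e≡) (arcWalk (I + t) (ℓ ∸ t))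
      , subst (ℓ ∸ t + δ ≤_) (sym (proj₂ arc)) (e+δ≤arc (m∸n≤m ℓ t))
      where
      I+t+e≡ : I + t + (ℓ ∸ t) ≡ I + ℓ
      I+t+e≡ = trans (+-assoc I t (ℓ ∸ t)) (cong (I +_) (m+[n∸m]≡n t≤ℓ))
      I+t+[1+e]≡ : I + suc ℓ ≡ I + t + suc (ℓ ∸ t)
      I+t+[1+e]≡ = sym (trans (+-suc (I + t) (ℓ ∸ t)) (trans (cong suc I+t+e≡) (sym (+-suc I ℓ))))
      arc = apart (I + t) (suc (ℓ ∸ t)) c≡ (cong (at C) I+t+[1+e]≡) (s≤s z≤n) (1+e<g (m∸n≤m ℓ t))

    end-liesBeyond : LiesBeyond δ (at C (I + ℓ)) ((I + suc ℓ) mod g C)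
    end-liesBeyond c active = let (_ , t≤ℓ , c≡) = proj₂ cov c active in end-behind t≤ℓ c≡

    end-edge : CycEdge C (at C (I + ℓ)) (vtx C ((I + suc ℓ) mod g C))
    end-edge = I + ℓ , inj₁ (refl , cong (at C) (+-suc I ℓ))

    start-behind : ∀ {c t} → t ≤ ℓ → vtx C c ≡ at C (I + t) →
                   Behind δ (at C I) ((I + (g C ∸ 1)) mod g C) c
    start-behind {c} {t} t≤ℓ c≡ = proj₁ arc , t
      , subst (λ a → Walk Adj a (at C I) t) (sym c≡) (reverseʷ Adj-sym (arcWalk I t))
      , subst (t + δ ≤_) (sym (trans (proj₂ arc) (shorterArc-complement (<⇒≤ (1+e<g t≤ℓ)))))
              (e+δ≤arc t≤ℓ)
      where
      I+[g∸1]≡ : I + (g C ∸ 1) ≡ I + t + (g C ∸ suc t)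
      I+[g∸1]≡ = trans (cong (I +_) (sym (cong pred (m+[n∸m]≡n (<⇒≤ (1+e<g t≤ℓ))))))
                       (sym (+-assoc I t _))
      arc = apart (I + t) (g C ∸ suc t) c≡ (cong (at C) I+[g∸1]≡) (m<n⇒0<n∸m (1+e<g t≤ℓ))
                  (s≤s (m∸n≤m (2 + m C) t))

    start-liesBeyond : LiesBeyond δ (at C I) ((I + (g C ∸ 1)) mod g C)
    start-liesBeyond c active = let (_ , t≤ℓ , c≡) = proj₂ cov c active in start-behind t≤ℓ c≡

    start-edge : CycEdge C (at C I) (vtx C ((I + (g C ∸ 1)) mod g C))
    start-edge = I + (g C ∸ 1) , inj₂ (refl , at-cong I (suc (I + (g C ∸ 1))) I≡)
      where
      I≡ : I % g C ≡ suc (I + (g C ∸ 1)) % g C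
      I≡ = sym (trans (cong (_% g C) (sym (+-suc I (g C ∸ 1)))) ([m+n]%n≡m%n I (g C)))

  liesBeyond⇒gapNeighbour : ∀ {δ v x} → CycEdge C v (vtx C x) → LiesBeyond δ v x → GapNeighbour G S δ C v
  liesBeyond⇒gapNeighbour {x = x} v~x beyond =
    vtx C x , v~x , liesBeyond⇒gap (CycEdge⇒OnCycle v~x) beyond

  endOfSPath⇒gapNeighbour : ∀ {b δ v} → δ ≤ 1 →
                            (∀ {ℓ} → ℓ ≤ b → δ + (suc ℓ + suc ℓ) ≤ suc (g C)) →
                            EndOfSPathWithin G S C b v → GapNeighbour G S δ C v
  endOfSPath⇒gapNeighbour {δ = δ} δ≤1 fits (i , ℓ , (cov , _) , inj₁ v≡start , ℓ≤b) =
    subst (GapNeighbour G S δ C) (sym v≡start) (liesBeyond⇒gapNeighbour start-edge start-liesBeyond)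
    where open Ends {i} cov δ≤1 (fits ℓ≤b)
  endOfSPath⇒gapNeighbour {δ = δ} δ≤1 fits (i , ℓ , (cov , _) , inj₂ v≡end , ℓ≤b) =
    subst (GapNeighbour G S δ C) (sym v≡end) (liesBeyond⇒gapNeighbour end-edge end-liesBeyond)
    where open Ends {i} cov δ≤1 (fits ℓ≤b)

⌊n/2⌋+⌊n/2⌋≤n : ∀ n → ⌊ n /2⌋ + ⌊ n /2⌋ ≤ n
⌊n/2⌋+⌊n/2⌋≤n n = ≤-trans (+-monoʳ-≤ ⌊ n /2⌋ (⌊n/2⌋≤⌈n/2⌉ n)) (≤-reflexive (⌊n/2⌋+⌈n/2⌉≡n n))

module _ {G : Graph} {S : Subset (Graph.n G)} (connected : Connected G) (disjoint : CyclesEdgeDisjoint G) where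
  open Graph G using (Adj; irrefl)
  open CycleGeometry using (CycEdge⇒Adj)

  vertexCritical⇒gapNeighbour : ∀ {C v} → VertexCritical G S C v → GapNeighbour G S 1 C v
  vertexCritical⇒gapNeighbour {C} = SPathEnds.endOfSPath⇒gapNeighbour C disjoint connected S (s≤s z≤n) fits
    where
    fits : ∀ {ℓ} → ℓ ≤ ⌊ g C /2⌋ ∸ 1 → 1 + (suc ℓ + suc ℓ) ≤ suc (g C)
    fits ℓ≤ = s≤s (≤-trans (+-mono-≤ (s≤s ℓ≤) (s≤s ℓ≤)) (⌊n/2⌋+⌊n/2⌋≤n (g C)))

  edgeCritical⇒gapNeighbour : ∀ {C v} → EdgeCritical G S C v → GapNeighbour G S 0 C v
  edgeCritical⇒gapNeighbour {C} = SPathEnds.endOfSPath⇒gapNeighbour C disjoint connected S z≤n fits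
    where
    fits : ∀ {ℓ} → ℓ ≤ ⌈ g C /2⌉ ∸ 1 → 0 + (suc ℓ + suc ℓ) ≤ suc (g C)
    fits ℓ≤ = ≤-trans (+-mono-≤ (s≤s ℓ≤) (s≤s ℓ≤)) (⌊n/2⌋+⌊n/2⌋≤n (suc (g C)))

  neighbours-differ : ∀ C D {v x y} → ¬ SameCycle G C D → CycEdge C v x → CycEdge D v y → x ≢ y
  neighbours-differ C D {v} {x} C≢D vx∈C vy∈D refl = disjoint C D C≢D v x vx∈C vy∈D

  neighbour-edges-differ : ∀ C D {v x y} → ¬ SameCycle G C D → CycEdge C v x → CycEdge D v y →
                           ¬ SameEdge G v x v y
  neighbour-edges-differ C D C≢D vx∈C vy∈D (inj₁ (_ , x≡y)) = neighbours-differ C D C≢D vx∈C vy∈D x≡y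
  neighbour-edges-differ C D {v} _ vx∈C _ (inj₂ (_ , x≡v)) =
    irrefl (subst (Adj v) x≡v (CycEdge⇒Adj C vx∈C))

  dist-beyond : ∀ {s v x d} → Adj v x → Dist G s v d → (∀ {m} → Walk Adj s x m → d + 1 ≤ m) →
                Dist G s x (suc d)
  dist-beyond {d = d} v~x (W , _) gap =
    snocʷ W v~x , λ m W′ → subst (_≤ m) (+-comm d 1) (gap W′)

  edgeDist-beyond : ∀ {s v x d} → Adj v x → Dist G s v d → (∀ {m} → Walk Adj s x m → d + 0 ≤ m) →
                    EdgeDist G s v x d
  edgeDist-beyond {d = d} v~x dist gap with shortestWalk G (snocʷ (proj₁ dist) v~x)
  ... | d′ , dist′ =
    d , d′ , dist , dist′ , sym (m≤n⇒m⊓n≡m (subst (_≤ d′) (+-identityʳ d) (gap (proj₁ dist′))))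

  vertexGenerator⇒¬incident : VertexMetricGenerator G S → ∀ C D → ¬ VertexCriticallyIncident G S C D
  vertexGenerator⇒¬incident generator C D (C≢D , v , critC , critD)
    with vertexCritical⇒gapNeighbour {C} critC | vertexCritical⇒gapNeighbour {D} critD
  ... | x , vx∈C , gapˣ | y , vy∈D , gapʸ with generator x y (neighbours-differ C D C≢D vx∈C vy∈D)
  ... | s , s∈S , distinguishes with shortestWalk G (proj₂ (connected s v))
  ... | d , dist = distinguishes (suc d) (suc d)
    (dist-beyond (CycEdge⇒Adj C vx∈C) dist (gapˣ s∈S dist))
    (dist-beyond (CycEdge⇒Adj D vy∈D) dist (gapʸ s∈S dist)) refl

  edgeGenerator⇒¬incident : EdgeMetricGenerator G S → ∀ C D → ¬ EdgeCriticallyIncident G S C D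
  edgeGenerator⇒¬incident generator C D (C≢D , v , critC , critD)
    with edgeCritical⇒gapNeighbour {C} critC | edgeCritical⇒gapNeighbour {D} critD
  ... | x , vx∈C , gapˣ | y , vy∈D , gapʸ
    with generator v x v y (CycEdge⇒Adj C vx∈C) (CycEdge⇒Adj D vy∈D)
                   (neighbour-edges-differ C D C≢D vx∈C vy∈D)
  ... | s , s∈S , distinguishes with shortestWalk G (proj₂ (connected s v))
  ... | d , dist = distinguishes d d
    (edgeDist-beyond (CycEdge⇒Adj C vx∈C) dist (gapˣ s∈S dist))
    (edgeDist-beyond (CycEdge⇒Adj D vy∈D) dist (gapʸ s∈S dist)) refl

lemma10 : (G : Graph) (S : Subset (Graph.n G)) →
    Cactus G → Biactive G S → BranchResolving G S →
    (VertexMetricGenerator G S → ∀ (C D : Cycle G) → ¬ VertexCriticallyIncident G S C D)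
    × (EdgeMetricGenerator G S → ∀ (C D : Cycle G) → ¬ EdgeCriticallyIncident G S C D)
-- Neither biactivity nor branch resolution is needed.
lemma10 G S (connected , disjoint) _ _ =
  vertexGenerator⇒¬incident connected disjoint , edgeGenerator⇒¬incident connected disjoint
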